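{- Let $P,Q\subset\mathbb{R}^d/\mathbb{R}\mathbf{1}$ be finite with $|P|=|Q|=n$, and let index maps $i,j:P\cup Q\to\{1,\dots,d\}$ satisfy $i(\xi)\ne j(\xi)$ for all $\xi\in P\cup Q$ and $i(p)\ne i(q)$ for all $p\in P$, $q\in Q$. If $P$ and $Q$ are both non-empty and $\mathcal{C}\ge1$, then the objective function of the soft margin linear program is bounded above over all feasible solutions $(z;\alpha;\beta;\gamma;\omega)$; that is, the maximum of the objective function is a finite real number.
   Context: $\mathbb{R}^d/\mathbb{R}\mathbf{1}$ is the tropical projective torus. For a constant $\mathcal{C}>0$, the soft margin linear program has variables $z\in\mathbb{R}$, $\omega\in\mathbb{R}^d$, and slack variables $\alpha_\xi,\beta_\xi$ ($\xi\in P\cup Q$) and $\gamma_{\xi,l}$ ($\xi\in P\cup Q$, $l\ne i(\xi),j(\xi)$); it maximizes $z-\mathcal{C}\sum_{\xi\in P\cup Q}\big(\alpha_\xi+\beta_\xi+\sum_{l\ne i(\xi),j(\xi)}\gamma_{\xi,l}\big)$ subject to, for all $\xi\in P\cup Q$: $z+\xi_{j(\xi)}+\omega_{j(\xi)}-\xi_{i(\xi)}-\omega_{i(\xi)}\le\alpha_\xi$; $\omega_{j(\xi)}-\omega_{i(\xi)}\le\xi_{i(\xi)}-\xi_{j(\xi)}+\beta_\xi$; $\omega_l-\omega_{j(\xi)}\le\xi_{j(\xi)}-\xi_l+\gamma_{\xi,l}$ for all $l\ne i(\xi),j(\xi)$; and $\alpha_\xi\ge0$, $\beta_\xi\ge0$,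 $\gamma_{\xi,l}\ge0$, $z\ge0$. -}

module Defs where

open import Level using (Level; _⊔_) renaming (suc to lsuc)
open import Data.Nat using (ℕ; zero; suc)
open import Data.Fin using (Fin; zero; suc; _≟_)
open import Data.Sum using (_⊎_; inj₁; inj₂; [_,_])
open import Data.Product using (∃; _×_)
open import Data.Bool using (if_then_else_; _∨_)
open import Relation.Nullary using (¬_; does)
open import Relation.Binary.Core using (Rel)
open import Relation.Binary.Structures using (IsTotalOrder)
open import Relation.Binary.PropositionalEquality using (_≢_)
open import Algebra.Bundles using (CommutativeRing)

-- An ordered field (the real numbers ℝ are an instance).  Equality is the
-- setoid equality of the underlying commutative ring.
record OrderedField (c ℓ₁ ℓ₂ : Level) : Set (lsuc (c ⊔ ℓ₁ ⊔ ℓ₂)) where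
  field
    commutativeRing : CommutativeRing c ℓ₁
  open CommutativeRing commutativeRing public
  infix 4 _≤_
  field
    _≤_          : Rel Carrier ℓ₂
    isTotalOrder : IsTotalOrder _≈_ _≤_
    +-mono-≤     : ∀ {x y} z → x ≤ y → (x + z) ≤ (y + z)
    *-nonneg     : ∀ {x y} → 0# ≤ x → 0# ≤ y → 0# ≤ (x * y)
    0≉1          : ¬ (0# ≈ 1#)
    inverse      : ∀ x → ¬ (x ≈ 0#) → ∃ λ y → (x * y) ≈ 1#

-- The soft margin linear program, for data:
--   d : ambient dimension (coordinates indexed by Fin d),
--   n : |P| = |Q|,
--   P Q : the points (representatives in F^d of points of F^d / F·1),
--   i j : index maps on P ∪ Q = Fin n ⊎ Fin n  (inj₁ = P, inj₂ = Q),
--   C : the penalty constant.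
module SoftMargin {c ℓ₁ ℓ₂} (F : OrderedField c ℓ₁ ℓ₂) where
  open OrderedField F using (Carrier; _+_; _*_; -_; 0#; 1#; _≤_)

  Σ : ∀ {m} → (Fin m → Carrier) → Carrier
  Σ {zero}  f = 0#
  Σ {suc m} f = f zero + Σ (λ k → f (suc k))

  -- variables of the linear program: z, ω, α_ξ, β_ξ, γ_{ξ,l}
  -- (γ ξ l is only used for l ≠ i ξ, j ξ)
  record Solution (d n : ℕ) : Set c where
    field
      z : Carrier
      ω : Fin d → Carrier
      α : Fin n ⊎ Fin n → Carrier
      β : Fin n ⊎ Fin n → Carrier
      γ : Fin n ⊎ Fin n → Fin d → Carrier

  module _ {d n : ℕ} (P Q : Fin n → Fin d → Carrier)
           (i j : Fin n ⊎ Fin n → Fin d) where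

    pt : Fin n ⊎ Fin n → Fin d → Carrier
    pt = [ P , Q ]

    Feasible : Solution d n → Set ℓ₂
    Feasible s =
        (∀ ξ → (z + pt ξ (j ξ) + ω (j ξ) + - pt ξ (i ξ) + - ω (i ξ)) ≤ α ξ)
      × (∀ ξ → (ω (j ξ) + - ω (i ξ)) ≤ (pt ξ (i ξ) + - pt ξ (j ξ) + β ξ))
      × (∀ ξ l → l ≢ i ξ → l ≢ j ξ →
           (ω l + - ω (j ξ)) ≤ (pt ξ (j ξ) + - pt ξ l + γ ξ l))
      × (∀ ξ → 0# ≤ α ξ)
      × (∀ ξ → 0# ≤ β ξ)
      × (∀ ξ l → l ≢ i ξ → l ≢ j ξ → 0# ≤ γ ξ l)
      × (0# ≤ z)
      where open Solution s

    γ-sum : Solution d n → (Fin n ⊎ Fin n) → Carrier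
    γ-sum s ξ = Σ (λ l → if does (l ≟ i ξ) ∨ does (l ≟ j ξ) then 0# else γ ξ l)
      where open Solution s

    slack : Solution d n → (Fin n ⊎ Fin n) → Carrier
    slack s ξ = α ξ + β ξ + γ-sum s ξ
      where open Solution s

    objective : Carrier → Solution d n → Carrier
    objective C s =
      Solution.z s + - (C * (Σ (λ a → slack s (inj₁ a)) + Σ (λ b → slack s (inj₂ b))))

-- Fix a point ξ of P and a point η of Q; since i ξ ≠ i η, the constraints of ξ and η
-- can be chained around the cycle of coordinates i ξ → j ξ → i η → j η → i ξ.  The
-- α-constraint of ξ bounds z by ω (i ξ) − ω (j ξ) plus slack, and along the cycle this
-- difference telescopes into three differences of ω, bounded by the β-constraint of η
-- and the γ-constraints of ξ and η.  The ω-variables cancel, leaving z ≤ M + slack for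
-- a constant M depending only on the data, and C ≥ 1 makes the penalty absorb the slack.
module Submission where

open import Defs
open import Level using (Level)
open import Data.Nat using (ℕ; _≤_; s≤s)
open import Data.Fin using (Fin; zero; suc; _≟_)
open import Data.Sum using (_⊎_; inj₁; inj₂)
open import Data.Product using (∃; _,_)
open import Data.Empty using (⊥-elim)
open import Relation.Nullary using (yes; no; does)
open import Data.Bool using (if_then_else_; _∨_)
open import Relation.Binary.Bundles using (Poset)
open import Relation.Binary.Structures using (IsTotalOrder)
open import Relation.Binary.PropositionalEquality using (_≡_; _≢_; ≢-sym)
  renaming (refl to ≡-refl)
import Relation.Binary.Reasoning.PartialOrder as PartialOrderReasoning
import Algebra.Properties.AbelianGroup as AbelianGroupProperties
import Algebra.Solver.CommutativeMonoid as CommutativeMonoidSolver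

module OrderedFieldProperties {c ℓ₁ ℓ₂ : Level} (F : OrderedField c ℓ₁ ℓ₂) where
  open OrderedField F hiding (zero) renaming (_≤_ to _≤F_)
  open SoftMargin F using (Σ)
  open AbelianGroupProperties +-abelianGroup using (//-rightDividesˡ; //-rightDividesʳ; \\-leftDividesʳ)
  open IsTotalOrder isTotalOrder using (isPartialOrder)
  open IsTotalOrder isTotalOrder public using () renaming (refl to ≤-refl; trans to ≤-trans)

  poset : Poset c ℓ₁ ℓ₂
  poset = record { isPartialOrder = isPartialOrder }

  module ≤-Reasoning = PartialOrderReasoning poset

  open ≤-Reasoning

  x-y+[y-z]≈x-z : ∀ x y z → (x - y) + (y - z) ≈ x - z
  x-y+[y-z]≈x-z x y z = begin-equality
    (x - y) + (y - z)    ≈⟨ +-assoc x (- y) (y - z) ⟩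
    x + (- y + (y - z))  ≈⟨ +-congˡ (\\-leftDividesʳ y (- z)) ⟩
    x - z                ∎

  +-monoʳ-≤ : ∀ {x y} z → x ≤F y → z + x ≤F z + y
  +-monoʳ-≤ {x} {y} z x≤y = begin
    z + x  ≈⟨ +-comm z x ⟩
    x + z  ≤⟨ +-mono-≤ z x≤y ⟩
    y + z  ≈⟨ +-comm y z ⟩
    z + y  ∎

  +-mono₂-≤ : ∀ {x y u v} → x ≤F y → u ≤F v → x + u ≤F y + v
  +-mono₂-≤ {x} {y} {u} {v} x≤y u≤v = begin
    x + u  ≤⟨ +-mono-≤ u x≤y ⟩
    y + u  ≤⟨ +-monoʳ-≤ y u≤v ⟩
    y + v  ∎

  x≤x+y : ∀ {x y} → 0# ≤F y → x ≤F x + y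
  x≤x+y {x} {y} 0≤y = begin
    x       ≈⟨ +-identityʳ x ⟨
    x + 0#  ≤⟨ +-monoʳ-≤ x 0≤y ⟩
    x + y   ∎

  x≤y+x : ∀ {x y} → 0# ≤F y → x ≤F y + x
  x≤y+x {x} {y} 0≤y = begin
    x      ≤⟨ x≤x+y 0≤y ⟩
    x + y  ≈⟨ +-comm x y ⟩
    y + x  ∎

  +-nonneg : ∀ {x y} → 0# ≤F x → 0# ≤F y → 0# ≤F x + y
  +-nonneg {x} {y} 0≤x 0≤y = begin
    0#      ≤⟨ 0≤x ⟩
    x       ≤⟨ x≤x+y 0≤y ⟩
    x + y   ∎

  x-y≤z⇒x≤z+y : ∀ {x y z} → x - y ≤F z → x ≤F z + y
  x-y≤z⇒x≤z+y {x} {y} {z} x-y≤z = begin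
    x            ≈⟨ //-rightDividesˡ y x ⟨
    (x - y) + y  ≤⟨ +-mono-≤ y x-y≤z ⟩
    z + y        ∎

  x≤y+z⇒x-z≤y : ∀ {x y z} → x ≤F y + z → x - z ≤F y
  x≤y+z⇒x-z≤y {x} {y} {z} x≤y+z = begin
    x - z        ≤⟨ +-mono-≤ (- z) x≤y+z ⟩
    (y + z) - z  ≈⟨ //-rightDividesʳ z y ⟩
    y            ∎

  x≤y*x : ∀ {x y} → 1# ≤F y → 0# ≤F x → x ≤F y * x
  x≤y*x {x} {y} 1≤y 0≤x = begin
    x                      ≤⟨ x≤y+x (*-nonneg 0≤y-1 0≤x) ⟩
    (y - 1#) * x + x       ≈⟨ +-congˡ (*-identityˡ x) ⟨
    (y - 1#) * x + 1# * x  ≈⟨ distribʳ x (y - 1#) 1# ⟨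
    ((y - 1#) + 1#) * x    ≈⟨ *-congʳ (//-rightDividesˡ 1# y) ⟩
    y * x                  ∎
    where
    0≤y-1 : 0# ≤F y - 1#
    0≤y-1 = begin
      0#       ≈⟨ -‿inverseʳ 1# ⟨
      1# - 1#  ≤⟨ +-mono-≤ (- 1#) 1≤y ⟩
      y - 1#   ∎

  Σ-nonneg : ∀ {m} {f : Fin m → Carrier} → (∀ k → 0# ≤F f k) → 0# ≤F Σ f
  Σ-nonneg {ℕ.zero}  0≤f = ≤-refl
  Σ-nonneg {ℕ.suc m} 0≤f = +-nonneg (0≤f zero) (Σ-nonneg (λ k → 0≤f (suc k)))

  term≤Σ : ∀ {m} {f : Fin m → Carrier} → (∀ k → 0# ≤F f k) → ∀ k → f k ≤F Σ f
  term≤Σ 0≤f zero    = x≤x+y (Σ-nonneg (λ k → 0≤f (suc k)))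
  term≤Σ 0≤f (suc k) = ≤-trans (term≤Σ (λ k → 0≤f (suc k)) k) (x≤y+x (0≤f zero))

module SoftMarginBounds {c ℓ₁ ℓ₂ : Level} (F : OrderedField c ℓ₁ ℓ₂) where
  open OrderedField F hiding (zero) renaming (_≤_ to _≤F_)
  open SoftMargin F
  open OrderedFieldProperties F
  open ≤-Reasoning
  open AbelianGroupProperties +-abelianGroup using (⁻¹-∙-comm; ⁻¹-anti-homo‿-)
  open CommutativeMonoidSolver +-commutativeMonoid using (solve; _⊜_; _⊕_)

  module _ {d n : ℕ} (P Q : Fin n → Fin d → Carrier) (i j : Fin n ⊎ Fin n → Fin d) where
    open Solution

    coord : Fin n ⊎ Fin n → Fin d → Carrier
    coord = pt P Q i j

    γ-summand : Solution d n → Fin n ⊎ Fin n → Fin d → Carrier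
    γ-summand s ξ l = if does (l ≟ i ξ) ∨ does (l ≟ j ξ) then 0# else γ s ξ l

    γ-summand-nonneg : ∀ {s} → Feasible P Q i j s → ∀ ξ l → 0# ≤F γ-summand s ξ l
    γ-summand-nonneg (_ , _ , _ , _ , _ , γ≥0 , _) ξ l with l ≟ i ξ | l ≟ j ξ
    ... | yes _   | _       = ≤-refl
    ... | no _    | yes _   = ≤-refl
    ... | no l≢iξ | no l≢jξ = γ≥0 ξ l l≢iξ l≢jξ

    γ-summand≡γ : ∀ s {ξ l} → l ≢ i ξ → l ≢ j ξ → γ-summand s ξ l ≡ γ s ξ l
    γ-summand≡γ s {ξ} {l} l≢iξ l≢jξ with l ≟ i ξ | l ≟ j ξ
    ... | yes l≡iξ | _        = ⊥-elim (l≢iξ l≡iξ)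
    ... | no _     | yes l≡jξ = ⊥-elim (l≢jξ l≡jξ)
    ... | no _     | no _     = ≡-refl

    γ-sum-nonneg : ∀ {s} → Feasible P Q i j s → ∀ ξ → 0# ≤F γ-sum P Q i j s ξ
    γ-sum-nonneg feasible ξ = Σ-nonneg (γ-summand-nonneg feasible ξ)

    γ≤γ-sum : ∀ {s} → Feasible P Q i j s → ∀ ξ {l} → l ≢ i ξ → l ≢ j ξ →
              γ s ξ l ≤F γ-sum P Q i j s ξ
    γ≤γ-sum {s} feasible ξ {l} l≢iξ l≢jξ = begin
      γ s ξ l              ≡⟨ γ-summand≡γ s l≢iξ l≢jξ ⟨
      γ-summand s ξ l      ≤⟨ term≤Σ (γ-summand-nonneg feasible ξ) l ⟩
      γ-sum P Q i j s ξ    ∎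

    slack-nonneg : ∀ {s} → Feasible P Q i j s → ∀ ξ → 0# ≤F slack P Q i j s ξ
    slack-nonneg feasible@(_ , _ , _ , α≥0 , β≥0 , _ , _) ξ =
      +-nonneg (+-nonneg (α≥0 ξ) (β≥0 ξ)) (γ-sum-nonneg feasible ξ)

    -- The γ-constraint of ξ, extended to l = j ξ where it holds trivially.
    ω-gap≤ : ∀ {s} → Feasible P Q i j s → ∀ ξ {l} → l ≢ i ξ →
             ω s l - ω s (j ξ) ≤F (coord ξ (j ξ) - coord ξ l) + γ-sum P Q i j s ξ
    ω-gap≤ {s} feasible@(_ , _ , γ-constraint , _) ξ {l} l≢iξ with l ≟ j ξ
    ... | yes ≡-refl = begin
      ω s l - ω s l                                ≈⟨ -‿inverseʳ (ω s l) ⟩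
      0#                                           ≈⟨ -‿inverseʳ (coord ξ l) ⟨
      coord ξ l - coord ξ l                        ≤⟨ x≤x+y (γ-sum-nonneg feasible ξ) ⟩
      (coord ξ l - coord ξ l) + γ-sum P Q i j s ξ  ∎
    ... | no l≢jξ = begin
      ω s l - ω s (j ξ)                                ≤⟨ γ-constraint ξ l l≢iξ l≢jξ ⟩
      (coord ξ (j ξ) - coord ξ l) + γ s ξ l            ≤⟨ +-monoʳ-≤ _ (γ≤γ-sum feasible ξ l≢iξ l≢jξ) ⟩
      (coord ξ (j ξ) - coord ξ l) + γ-sum P Q i j s ξ  ∎

    z≤α+gap : ∀ {s} → Feasible P Q i j s → ∀ ξ →
              z s ≤F α s ξ + ((coord ξ (i ξ) - coord ξ (j ξ)) + (ω s (i ξ) - ω s (j ξ)))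
    z≤α+gap {s} (α-constraint , _) ξ = x-y≤z⇒x≤z+y (begin
      z s - ((b - a) + (v - w))      ≈⟨ +-congˡ (⁻¹-∙-comm (b - a) (v - w)) ⟨
      z s + (- (b - a) + - (v - w))  ≈⟨ +-congˡ (+-cong (⁻¹-anti-homo‿- b a) (⁻¹-anti-homo‿- v w)) ⟩
      z s + ((a - b) + (w - v))      ≈⟨ regroup (z s) a w (- b) (- v) ⟩
      z s + a + w - b - v            ≤⟨ α-constraint ξ ⟩
      α s ξ                          ∎)
      where
      a b w v : Carrier
      a = coord ξ (j ξ)
      b = coord ξ (i ξ)
      w = ω s (j ξ)
      v = ω s (i ξ)
      regroup : ∀ x₁ x₂ x₃ x₄ x₅ → x₁ + ((x₂ + x₄) + (x₃ + x₅)) ≈ x₁ + x₂ + x₃ + x₄ + x₅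
      regroup = solve 5 (λ x₁ x₂ x₃ x₄ x₅ →
        x₁ ⊕ ((x₂ ⊕ x₄) ⊕ (x₃ ⊕ x₅)) ⊜ (((x₁ ⊕ x₂) ⊕ x₃) ⊕ x₄) ⊕ x₅) refl

    -- The data-dependent part of the constraints chained along i ξ → j ξ → i η → j η → i ξ.
    cycle-cost : Fin n ⊎ Fin n → Fin n ⊎ Fin n → Carrier
    cycle-cost ξ η = (coord ξ (i ξ) - coord ξ (j ξ))
                   + (((coord η (j η) - coord η (i ξ)) + (coord η (i η) - coord η (j η)))
                      + (coord ξ (j ξ) - coord ξ (i η)))

    z≤cycle-cost+slack : ∀ {s} → Feasible P Q i j s → ∀ ξ η → i ξ ≢ i η →
                         z s ≤F cycle-cost ξ η + (slack P Q i j s ξ + slack P Q i j s η)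
    z≤cycle-cost+slack {s} feasible@(_ , β-constraint , _ , α≥0 , β≥0 , _ , _) ξ η iξ≢iη = begin
      z s
        ≤⟨ z≤α+gap feasible ξ ⟩
      α s ξ + (gap + (ω s (i ξ) - ω s (j ξ)))
        ≈⟨ +-congˡ (+-congˡ telescope) ⟨
      α s ξ + (gap + (((ω s (i ξ) - ω s (j η)) + (ω s (j η) - ω s (i η))) + (ω s (i η) - ω s (j ξ))))
        ≤⟨ +-monoʳ-≤ _ (+-monoʳ-≤ _ (+-mono₂-≤ (+-mono₂-≤ (ω-gap≤ feasible η iξ≢iη)
                                                          (β-constraint η))
                                               (ω-gap≤ feasible ξ (≢-sym iξ≢iη)))) ⟩
      α s ξ + (gap + (((k₁ + γ-sum P Q i j s η) + (k₂ + β s η)) + (k₃ + γ-sum P Q i j s ξ)))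
        ≈⟨ regroup (α s ξ) gap k₁ (γ-sum P Q i j s η) k₂ (β s η) k₃ (γ-sum P Q i j s ξ) ⟩
      cycle-cost ξ η + ((α s ξ + γ-sum P Q i j s ξ) + (β s η + γ-sum P Q i j s η))
        ≤⟨ +-monoʳ-≤ _ (+-mono₂-≤ (+-mono-≤ _ (x≤x+y (β≥0 ξ))) (+-mono-≤ _ (x≤y+x (α≥0 η)))) ⟩
      cycle-cost ξ η + (slack P Q i j s ξ + slack P Q i j s η)
        ∎
      where
      gap k₁ k₂ k₃ : Carrier
      gap = coord ξ (i ξ) - coord ξ (j ξ)
      k₁ = coord η (j η) - coord η (i ξ)
      k₂ = coord η (i η) - coord η (j η)
      k₃ = coord ξ (j ξ) - coord ξ (i η)
      telescope : ((ω s (i ξ) - ω s (j η)) + (ω s (j η) - ω s (i η))) + (ω s (i η) - ω s (j ξ))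
                  ≈ ω s (i ξ) - ω s (j ξ)
      telescope = trans (+-congʳ (x-y+[y-z]≈x-z _ _ _)) (x-y+[y-z]≈x-z _ _ _)
      regroup : ∀ a g x₁ γ₂ x₂ b x₃ γ₁ →
                a + (g + (((x₁ + γ₂) + (x₂ + b)) + (x₃ + γ₁)))
                ≈ (g + ((x₁ + x₂) + x₃)) + ((a + γ₁) + (b + γ₂))
      regroup = solve 8 (λ a g x₁ γ₂ x₂ b x₃ γ₁ →
        a ⊕ (g ⊕ (((x₁ ⊕ γ₂) ⊕ (x₂ ⊕ b)) ⊕ (x₃ ⊕ γ₁)))
        ⊜ (g ⊕ ((x₁ ⊕ x₂) ⊕ x₃)) ⊕ ((a ⊕ γ₁) ⊕ (b ⊕ γ₂))) refl

theorem8 : ∀ {c ℓ₁ ℓ₂} (F : OrderedField c ℓ₁ ℓ₂) →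
           let open OrderedField F renaming (_≤_ to _≤F_) in
           let open SoftMargin F in
           (d n : ℕ) (P Q : Fin n → Fin d → Carrier)
           (i j : Fin n ⊎ Fin n → Fin d) →
           (∀ ξ → i ξ ≢ j ξ) →
           (∀ a b → i (inj₁ a) ≢ i (inj₂ b)) →
           1 ≤ n →
           (C : Carrier) → 1# ≤F C →
           ∃ λ M → ∀ (s : Solution d n) → Feasible P Q i j s →
             objective P Q i j C s ≤F M
theorem8 F d (ℕ.suc m) P Q i j _ iP≢iQ (s≤s _) C 1≤C = cycle-cost P Q i j p q , objective≤
  where
  open OrderedField F hiding (zero) renaming (_≤_ to _≤F_)
  open SoftMargin F
  open OrderedFieldProperties F
  open SoftMarginBounds F
  open ≤-Reasoning
  p q : Fin (ℕ.suc m) ⊎ Fin (ℕ.suc m)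
  p = inj₁ zero
  q = inj₂ zero
  objective≤ : ∀ s → Feasible P Q i j s → objective P Q i j C s ≤F cycle-cost P Q i j p q
  objective≤ s feasible = x≤y+z⇒x-z≤y (begin
    Solution.z s
      ≤⟨ z≤cycle-cost+slack P Q i j feasible p q (iP≢iQ zero zero) ⟩
    M + (slack P Q i j s p + slack P Q i j s q)
      ≤⟨ +-monoʳ-≤ M (+-mono₂-≤ (term≤Σ slackP≥0 zero) (term≤Σ slackQ≥0 zero)) ⟩
    M + (S₁ + S₂)
      ≤⟨ +-monoʳ-≤ M (x≤y*x 1≤C (+-nonneg (Σ-nonneg slackP≥0) (Σ-nonneg slackQ≥0))) ⟩
    M + C * (S₁ + S₂)
      ∎)
    where
    M S₁ S₂ : Carrier
    M = cycle-cost P Q i j p q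
    S₁ = Σ (λ a → slack P Q i j s (inj₁ a))
    S₂ = Σ (λ b → slack P Q i j s (inj₂ b))
    slackP≥0 : ∀ a → 0# ≤F slack P Q i j s (inj₁ a)
    slackP≥0 a = slack-nonneg P Q i j feasible (inj₁ a)
    slackQ≥0 : ∀ b → 0# ≤F slack P Q i j s (inj₂ b)
    slackQ≥0 b = slack-nonneg P Q i j feasible (inj₂ b)
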